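{- For an overpartition $\alpha$, let $D(\alpha)$ be the size of its generalized Durfee square, i.e. the largest integer $N\ge 0$ such that (number of overlined parts of $\alpha$) $+$ (number of non-overlined parts of $\alpha$ that are $\ge N$) is $\ge N$. For $n\ge 0$ let $g(n)$ denote the number of overpartitions $\alpha$ of $n$ such that the number of parts of $\alpha$ equals $D(\alpha)$. Then \[ \sum_{n=0}^{\infty} g(n)q^n=\sum_{N=0}^{\infty}\frac{(-1;q)_N\,q^{N(N+1)/2}}{(q;q)_N}. \]
   Context: An overpartition of $n$ is a partition of $n$ (a non-increasing finite sequence of positive integers summing to $n$) in which the first occurrence of each distinct part value may be overlined; the empty overpartition is the unique overpartition of $0$. Notation: $(a;q)_n=\prod_{i=0}^{n-1}(1-aq^i)$, with $(a;q)_0=1$. -}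

module Defs where

open import Data.Bool using (Bool; true; false; _∧_; not; if_then_else_; T)
open import Data.Nat as ℕ using (ℕ; zero; suc; _∸_; _≤ᵇ_; _≡ᵇ_)
open import Data.Integer as ℤ using (ℤ; +_; -_)
open import Data.List using (List; []; _∷_; length)
open import Data.Product using (Σ; _×_; _,_; proj₁)

-- A part is a pair (value , overlined?).  An overpartition is a list of
-- parts written in non-increasing order of value.
Part : Set
Part = ℕ × Bool

weight : List Part → ℕ
weight []            = 0
weight ((a , _) ∷ α) = a ℕ.+ weight α

allPositive : List Part → Bool
allPositive []            = true
allPositive ((a , _) ∷ α) = (1 ≤ᵇ a) ∧ allPositive α

-- values non-increasing, and only the first occurrence of a value may be
-- overlined: if two consecutive parts have equal value, the later one is
-- not overlined.
wellOrdered : List Part → Bool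
wellOrdered []                              = true
wellOrdered (_ ∷ [])                        = true
wellOrdered ((a , _) ∷ (b , ob) ∷ α) =
  (b ≤ᵇ a) ∧ (if a ≡ᵇ b then not ob else true) ∧ wellOrdered ((b , ob) ∷ α)

IsOverpartitionOf : ℕ → List Part → Bool
IsOverpartitionOf n α = (weight α ≡ᵇ n) ∧ allPositive α ∧ wellOrdered α

numOverlined : List Part → ℕ
numOverlined []                = 0
numOverlined ((_ , true) ∷ α)  = suc (numOverlined α)
numOverlined ((_ , false) ∷ α) = numOverlined α

numPlainAtLeast : ℕ → List Part → ℕ
numPlainAtLeast N []                = 0
numPlainAtLeast N ((_ , true) ∷ α)  = numPlainAtLeast N α
numPlainAtLeast N ((a , false) ∷ α) =
  if N ≤ᵇ a then suc (numPlainAtLeast N α) else numPlainAtLeast N α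

durfeeCond : List Part → ℕ → Bool
durfeeCond α N = N ≤ᵇ (numOverlined α ℕ.+ numPlainAtLeast N α)

-- largest N ≤ k satisfying the condition (N = 0 always satisfies it)
largestUpTo : List Part → ℕ → ℕ
largestUpTo α zero    = 0
largestUpTo α (suc k) = if durfeeCond α (suc k) then suc k else largestUpTo α k

-- D(α): the largest N ≥ 0 with durfeeCond α N.  Any such N satisfies
-- N ≤ numOverlined + numPlainAtLeast N ≤ length α, so searching
-- downward from length α finds the maximum.
D : List Part → ℕ
D α = largestUpTo α (length α)

GSet : ℕ → Set
GSet n = Σ (List Part) λ α → T (IsOverpartitionOf n α ∧ (length α ≡ᵇ D α))

Series : Set
Series = ℕ → ℤ

sumTo : ℕ → (ℕ → ℤ) → ℤ
sumTo zero    f = f 0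
sumTo (suc n) f = sumTo n f ℤ.+ f (suc n)

constS : ℤ → Series
constS c zero    = c
constS c (suc _) = + 0

oneS : Series
oneS = constS (+ 1)

qPow : ℕ → Series
qPow m n = if m ≡ᵇ n then + 1 else + 0

_-ₛ_ : Series → Series → Series
(f -ₛ g) n = f n ℤ.- g n

_+ₛ_ : Series → Series → Series
(f +ₛ g) n = f n ℤ.+ g n

_*ₛ_ : Series → Series → Series
(f *ₛ g) n = sumTo n (λ k → f k ℤ.* g (n ∸ k))

poch : Series → ℕ → Series
poch a zero    = oneS
poch a (suc n) = poch a n *ₛ (oneS -ₛ (a *ₛ qPow n))

-- Multiplicative inverse of a series a with a 0 = 1:
-- b 0 = 1,  b m = - ∑_{j=0}^{m-1} a (m - j) * b j.
-- invUpTo a n holds the correct coefficients b 0 … b n.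
invUpTo : Series → ℕ → Series
invUpTo a zero    k = constS (+ 1) k
invUpTo a (suc n) k =
  if k ≡ᵇ suc n
  then ℤ.- sumTo n (λ j → a (suc n ∸ j) ℤ.* invUpTo a n j)
  else invUpTo a n k

inv : Series → Series
inv a k = invUpTo a k k

term : ℕ → Series
term N = (poch (constS (ℤ.- (+ 1))) N *ₛ qPow (N ℕ.* suc N ℕ./ 2)) *ₛ inv (poch (qPow 1) N)

-- coefficient of q^n in ∑_{N≥0} term N.  term N has order N(N+1)/2 ≥ N,
-- so only N ≤ n contribute to the coefficient of q^n.
rhsCoeff : ℕ → ℤ
rhsCoeff n = sumTo n (λ N → term N n)

-- Split an overpartition into the list O of its overlined parts (distinct)
-- and the list P of its non-overlined parts.  With N parts in all, N = D says
-- exactly that every non-overlined part is ≥ N (module Overpartitions), so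
-- g(n) = ∑_{N≤n} c(N, n), where c(N, n) counts the pairs (O , P) with N parts,
-- non-overlined parts ≥ N and weight n (module Summation).  Removing the first
-- column of a pair with N+1 parts gives (module Pairs)
--   c(N+1, n) = c(N+1, n-(N+1)) + c(N, n-(2N+1)) + c(N, n-(N+1)),
-- the three terms counting the pairs with (a) no overlined 1 and all
-- non-overlined parts > N+1, (b) no overlined 1 but a non-overlined part N+1,
-- which is deleted, (c) an overlined 1, which is deleted.  The summands T_N
-- obey the same recursion T_{N+1} = q^{N+1} T_{N+1} + q^{2N+1} T_N + q^{N+1} T_N
-- with T_0 = 1 (module PowerSeries), so c(N, n) = [q^n] T_N by strong
-- induction on n.

module Submission where

open import Defs

module PowerSeries where

  open import Data.Nat as ℕ using (ℕ; zero; suc; _∸_; _≡ᵇ_; _≤_; z≤n)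
  import Data.Nat.Properties as ℕP
  open import Data.Nat.DivMod using (m*n/n≡m)
  open import Data.Bool using (true; false)
  open import Data.Integer using (ℤ; +_; -_; _+_; _*_; _-_)
  import Data.Integer.Properties as ℤP
  open import Data.Integer.Tactic.RingSolver using (solve-∀)
  open import Data.Sum using (inj₁; inj₂)
  open import Relation.Binary.PropositionalEquality
  open ≡-Reasoning

  infix 4 _≐_

  _≐_ : Series → Series → Set
  F ≐ G = ∀ n → F n ≡ G n

  sumTo-cong : ∀ n {f g : ℕ → ℤ} → (∀ k → k ≤ n → f k ≡ g k) → sumTo n f ≡ sumTo n g
  sumTo-cong zero    eq = eq 0 z≤n
  sumTo-cong (suc n) eq =
    cong₂ _+_ (sumTo-cong n (λ k k≤n → eq k (ℕP.m≤n⇒m≤1+n k≤n))) (eq (suc n) ℕP.≤-refl)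

  sumTo-zero : ∀ n {f : ℕ → ℤ} → (∀ k → k ≤ n → f k ≡ + 0) → sumTo n f ≡ + 0
  sumTo-zero zero    eq = eq 0 z≤n
  sumTo-zero (suc n) eq =
    cong₂ _+_ (sumTo-zero n (λ k k≤n → eq k (ℕP.m≤n⇒m≤1+n k≤n))) (eq (suc n) ℕP.≤-refl)

  sumTo-suc : ∀ n (f : ℕ → ℤ) → sumTo (suc n) f ≡ f 0 + sumTo n (λ k → f (suc k))
  sumTo-suc zero    f = refl
  sumTo-suc (suc n) f =
    trans (cong (_+ f (suc (suc n))) (sumTo-suc n f)) (ℤP.+-assoc (f 0) _ _)

  sumTo-+ : ∀ n (f g : ℕ → ℤ) → sumTo n (λ k → f k + g k) ≡ sumTo n f + sumTo n g
  sumTo-+ zero    f g = refl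
  sumTo-+ (suc n) f g =
    trans (cong (_+ (f (suc n) + g (suc n))) (sumTo-+ n f g))
          (interchange (sumTo n f) (sumTo n g) (f (suc n)) (g (suc n)))
    where open import Algebra.Properties.CommutativeSemigroup ℤP.+-commutativeSemigroup
            using (interchange)

  sumTo-neg : ∀ n (f : ℕ → ℤ) → sumTo n (λ k → - f k) ≡ - sumTo n f
  sumTo-neg zero    f = refl
  sumTo-neg (suc n) f =
    trans (cong (_+ - f (suc n)) (sumTo-neg n f)) (sym (ℤP.neg-distrib-+ (sumTo n f) (f (suc n))))

  sumTo-reverse : ∀ n (f : ℕ → ℤ) → sumTo n f ≡ sumTo n (λ k → f (n ∸ k))
  sumTo-reverse zero    f = refl
  sumTo-reverse (suc n) f = begin
    sumTo n f + f (suc n)                    ≡⟨ ℤP.+-comm (sumTo n f) _ ⟩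
    f (suc n) + sumTo n f                    ≡⟨ cong (_+_ (f (suc n))) (sumTo-reverse n f) ⟩
    f (suc n) + sumTo n (λ k → f (n ∸ k))    ≡⟨ sym (sumTo-suc n (λ k → f (suc n ∸ k))) ⟩
    sumTo (suc n) (λ k → f (suc n ∸ k))      ∎

  mul-congˡ : ∀ {F F′} G → F ≐ F′ → (F *ₛ G) ≐ (F′ *ₛ G)
  mul-congˡ G eq n = sumTo-cong n (λ k _ → cong (_* G (n ∸ k)) (eq k))

  mul-congʳ : ∀ F {G G′} → G ≐ G′ → (F *ₛ G) ≐ (F *ₛ G′)
  mul-congʳ F eq n = sumTo-cong n (λ k _ → cong (F k *_) (eq (n ∸ k)))

  mul-comm : ∀ F G → (F *ₛ G) ≐ (G *ₛ F)
  mul-comm F G n = begin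
    sumTo n (λ k → F k * G (n ∸ k))               ≡⟨ sumTo-reverse n _ ⟩
    sumTo n (λ k → F (n ∸ k) * G (n ∸ (n ∸ k)))   ≡⟨ sumTo-cong n swap ⟩
    sumTo n (λ k → G k * F (n ∸ k))               ∎
    where
      swap : ∀ k → k ≤ n → F (n ∸ k) * G (n ∸ (n ∸ k)) ≡ G k * F (n ∸ k)
      swap k k≤n rewrite ℕP.m∸[m∸n]≡n k≤n = ℤP.*-comm (F (n ∸ k)) (G k)

  mul-constˡ : ∀ c F → (constS c *ₛ F) ≐ (λ n → c * F n)
  mul-constˡ c F zero    = refl
  mul-constˡ c F (suc n) = begin
    (constS c *ₛ F) (suc n)                           ≡⟨ sumTo-suc n _ ⟩
    c * F (suc n) + sumTo n (λ k → + 0 * F (n ∸ k))   ≡⟨ cong (_+_ (c * F (suc n))) (sumTo-zero n (λ _ _ → refl)) ⟩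
    c * F (suc n) + + 0                               ≡⟨ ℤP.+-identityʳ _ ⟩
    c * F (suc n)                                     ∎

  mul-oneʳ : ∀ F → (F *ₛ oneS) ≐ F
  mul-oneʳ F n = trans (mul-comm F oneS n) (trans (mul-constˡ (+ 1) F n) (ℤP.*-identityˡ (F n)))

  mul-distribʳ : ∀ F G H → ((F +ₛ G) *ₛ H) ≐ ((F *ₛ H) +ₛ (G *ₛ H))
  mul-distribʳ F G H n =
    trans (sumTo-cong n (λ k _ → ℤP.*-distribʳ-+ (H (n ∸ k)) (F k) (G k))) (sumTo-+ n _ _)

  mul-distribˡ : ∀ F G H → (F *ₛ (G +ₛ H)) ≐ ((F *ₛ G) +ₛ (F *ₛ H))
  mul-distribˡ F G H n =
    trans (sumTo-cong n (λ k _ → ℤP.*-distribˡ-+ (F k) (G (n ∸ k)) (H (n ∸ k)))) (sumTo-+ n _ _)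

  mul-minusʳ : ∀ F G H → ((F -ₛ G) *ₛ H) ≐ ((F *ₛ H) -ₛ (G *ₛ H))
  mul-minusʳ F G H n = trans (mul-distribʳ F (λ m → - G m) H n) (cong (_+_ ((F *ₛ H) n)) negate)
    where
      negate : sumTo n (λ k → - G k * H (n ∸ k)) ≡ - (G *ₛ H) n
      negate = trans (sumTo-cong n (λ k _ → sym (ℤP.neg-distribˡ-* (G k) (H (n ∸ k)))))
                     (sumTo-neg n _)

  mul-minusˡ : ∀ F G H → (F *ₛ (G -ₛ H)) ≐ ((F *ₛ G) -ₛ (F *ₛ H))
  mul-minusˡ F G H n =
    trans (mul-comm F (G -ₛ H) n)
          (trans (mul-minusʳ G H F n) (cong₂ _-_ (mul-comm G F n) (mul-comm H F n)))

  -- Multiplication by q and by q^s shifts the coefficient sequence.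

  shift1 : Series → Series
  shift1 F zero    = + 0
  shift1 F (suc n) = F n

  shift : ℕ → Series → Series
  shift zero    F = F
  shift (suc s) F = shift1 (shift s F)

  shift1-cong : ∀ {F G} → F ≐ G → shift1 F ≐ shift1 G
  shift1-cong eq zero    = refl
  shift1-cong eq (suc n) = eq n

  shift-cong : ∀ s {F G} → F ≐ G → shift s F ≐ shift s G
  shift-cong zero    eq = eq
  shift-cong (suc s) eq = shift1-cong (shift-cong s eq)

  shift-+ : ∀ s F G → shift s (F +ₛ G) ≐ (shift s F +ₛ shift s G)
  shift-+ zero    F G n       = refl
  shift-+ (suc s) F G zero    = refl
  shift-+ (suc s) F G (suc n) = shift-+ s F G n

  shift-neg : ∀ s F → shift s (λ m → - F m) ≐ (λ m → - shift s F m)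
  shift-neg zero    F n       = refl
  shift-neg (suc s) F zero    = refl
  shift-neg (suc s) F (suc n) = shift-neg s F n

  shift-shift : ∀ a b F → shift a (shift b F) ≐ shift (a ℕ.+ b) F
  shift-shift zero    b F n = refl
  shift-shift (suc a) b F   = shift1-cong (shift-shift a b F)

  qPow-shift : ∀ s → qPow s ≐ shift s oneS
  qPow-shift zero    zero    = refl
  qPow-shift zero    (suc n) = refl
  qPow-shift (suc s) zero    = refl
  qPow-shift (suc s) (suc n) = qPow-shift s n

  mul-shift1ˡ : ∀ F G → (shift1 F *ₛ G) ≐ shift1 (F *ₛ G)
  mul-shift1ˡ F G zero    = refl
  mul-shift1ˡ F G (suc n) = trans (sumTo-suc n _) (ℤP.+-identityˡ ((F *ₛ G) n))

  mul-shiftˡ : ∀ s F G → (shift s F *ₛ G) ≐ shift s (F *ₛ G)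
  mul-shiftˡ zero    F G n = refl
  mul-shiftˡ (suc s) F G n =
    trans (mul-shift1ˡ (shift s F) G n) (shift1-cong (mul-shiftˡ s F G) n)

  mul-shiftʳ : ∀ s F G → (F *ₛ shift s G) ≐ shift s (F *ₛ G)
  mul-shiftʳ s F G n =
    trans (mul-comm F (shift s G) n) (trans (mul-shiftˡ s G F n) (shift-cong s (mul-comm G F) n))

  mul-qPowʳ : ∀ s F → (F *ₛ qPow s) ≐ shift s F
  mul-qPowʳ s F n =
    trans (mul-congʳ F (qPow-shift s) n) (trans (mul-shiftʳ s F oneS n) (shift-cong s (mul-oneʳ F) n))

  mul-one-minus : ∀ F G → (F *ₛ (oneS -ₛ G)) ≐ (F -ₛ (F *ₛ G))
  mul-one-minus F G n = trans (mul-minusˡ F oneS G n) (cong (_- (F *ₛ G) n) (mul-oneʳ F n))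

  minusPoch : ℕ → Series
  minusPoch = poch (constS (- + 1))

  qPoch : ℕ → Series
  qPoch = poch (qPow 1)

  minusPoch-step : ∀ N → minusPoch (suc N) ≐ (minusPoch N +ₛ shift N (minusPoch N))
  minusPoch-step N n = begin
    minusPoch (suc N) n                ≡⟨ mul-one-minus P (c *ₛ qPow N) n ⟩
    P n - (P *ₛ (c *ₛ qPow N)) n       ≡⟨ cong (_-_ (P n)) (times-minus-qPow n) ⟩
    P n - - shift N P n                ≡⟨ cong (_+_ (P n)) (ℤP.neg-involutive (shift N P n)) ⟩
    P n + shift N P n                  ∎
    where
      P c : Series
      P = minusPoch N
      c = constS (- + 1)
      times-minus-one : (P *ₛ c) ≐ (λ m → - P m)
      times-minus-one m = trans (mul-comm P c m) (trans (mul-constˡ (- + 1) P m) (ℤP.-1*i≡-i (P m)))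
      times-minus-qPow : (P *ₛ (c *ₛ qPow N)) ≐ (λ m → - shift N P m)
      times-minus-qPow m = begin
        (P *ₛ (c *ₛ qPow N)) m      ≡⟨ mul-congʳ P (mul-qPowʳ N c) m ⟩
        (P *ₛ shift N c) m          ≡⟨ mul-shiftʳ N P c m ⟩
        shift N (P *ₛ c) m          ≡⟨ shift-cong N times-minus-one m ⟩
        shift N (λ k → - P k) m     ≡⟨ shift-neg N P m ⟩
        - shift N P m               ∎

  qPoch-step : ∀ N → qPoch (suc N) ≐ (qPoch N -ₛ shift (suc N) (qPoch N))
  qPoch-step N n = begin
    qPoch (suc N) n                    ≡⟨ mul-one-minus Q (qPow 1 *ₛ qPow N) n ⟩
    Q n - (Q *ₛ (qPow 1 *ₛ qPow N)) n  ≡⟨ cong (_-_ (Q n)) (times-qPow n) ⟩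
    Q n - shift (suc N) Q n            ∎
    where
      Q : Series
      Q = qPoch N
      q^N+1 : (qPow 1 *ₛ qPow N) ≐ shift (suc N) oneS
      q^N+1 m = trans (mul-comm (qPow 1) (qPow N) m)
                      (trans (mul-qPowʳ 1 (qPow N) m) (shift1-cong (qPow-shift N) m))
      times-qPow : (Q *ₛ (qPow 1 *ₛ qPow N)) ≐ shift (suc N) Q
      times-qPow m = begin
        (Q *ₛ (qPow 1 *ₛ qPow N)) m  ≡⟨ mul-congʳ Q q^N+1 m ⟩
        (Q *ₛ shift (suc N) oneS) m  ≡⟨ mul-shiftʳ (suc N) Q oneS m ⟩
        shift (suc N) (Q *ₛ oneS) m  ≡⟨ shift-cong (suc N) (mul-oneʳ Q) m ⟩
        shift (suc N) Q m            ∎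

  qPoch-constant : ∀ N → qPoch N 0 ≡ + 1
  qPoch-constant zero    = refl
  qPoch-constant (suc N) =
    trans (qPoch-step N 0) (trans (ℤP.+-identityʳ (qPoch N 0)) (qPoch-constant N))

  private
    ≡ᵇ-self : ∀ n → (n ≡ᵇ n) ≡ true
    ≡ᵇ-self zero    = refl
    ≡ᵇ-self (suc n) = ≡ᵇ-self n

    ≡ᵇ-larger : ∀ j d → (j ≡ᵇ suc (d ℕ.+ j)) ≡ false
    ≡ᵇ-larger zero    d = refl
    ≡ᵇ-larger (suc j) d rewrite ℕP.+-suc d j = ≡ᵇ-larger j d

  invUpTo-stable : ∀ a d j → invUpTo a (d ℕ.+ j) j ≡ inv a j
  invUpTo-stable a zero    j = refl
  invUpTo-stable a (suc d) j rewrite ≡ᵇ-larger j d = invUpTo-stable a d j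

  inv-suc : ∀ a n → inv a (suc n) ≡ - sumTo n (λ j → a (suc n ∸ j) * inv a j)
  inv-suc a n rewrite ≡ᵇ-self n = cong -_ (sumTo-cong n stable)
    where
      stable : ∀ j → j ≤ n → a (suc n ∸ j) * invUpTo a n j ≡ a (suc n ∸ j) * inv a j
      stable j j≤n = cong (a (suc n ∸ j) *_)
        (trans (cong (λ m → invUpTo a m j) (sym (ℕP.m∸n+n≡m j≤n))) (invUpTo-stable a (n ∸ j) j))

  mul-last : ∀ a Y m → (a *ₛ Y) (suc m) ≡ sumTo m (λ j → a (suc m ∸ j) * Y j) + a 0 * Y (suc m)
  mul-last a Y m = trans (mul-comm a Y (suc m)) (cong₂ _+_ (sumTo-cong m (λ j _ → ℤP.*-comm (Y j) _)) last)
    where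
      last : Y (suc m) * a (m ∸ m) ≡ a 0 * Y (suc m)
      last rewrite ℕP.n∸n≡0 m = ℤP.*-comm (Y (suc m)) (a 0)

  inv-inverse : ∀ a → a 0 ≡ + 1 → (a *ₛ inv a) ≐ oneS
  inv-inverse a a0 zero rewrite a0 = refl
  inv-inverse a a0 (suc m) = begin
    (a *ₛ inv a) (suc m)          ≡⟨ mul-last a (inv a) m ⟩
    S + a 0 * inv a (suc m)       ≡⟨ cong₂ (λ c x → S + c * x) a0 (inv-suc a m) ⟩
    S + + 1 * - S                 ≡⟨ cong (_+_ S) (ℤP.*-identityˡ (- S)) ⟩
    S + - S                       ≡⟨ ℤP.+-inverseʳ S ⟩
    + 0                           ∎
    where
      S : ℤ
      S = sumTo m (λ j → a (suc m ∸ j) * inv a j)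

  inv-unique : ∀ a Y → a 0 ≡ + 1 → (a *ₛ Y) ≐ oneS → Y ≐ inv a
  inv-unique a Y a0 aY n = agree n n ℕP.≤-refl
    where
      open import Algebra.Properties.AbelianGroup ℤP.+-0-abelianGroup using (inverseʳ-unique)
      agree : ∀ m k → k ≤ m → Y k ≡ inv a k
      agree zero zero _ = begin
        Y 0            ≡⟨ sym (ℤP.*-identityˡ (Y 0)) ⟩
        + 1 * Y 0      ≡⟨ cong (_* Y 0) (sym a0) ⟩
        a 0 * Y 0      ≡⟨ aY 0 ⟩
        + 1            ∎
      agree (suc m) k k≤1+m with ℕP.m≤n⇒m<n∨m≡n k≤1+m
      ... | inj₁ k<1+m = agree m k (ℕP.≤-pred k<1+m)
      ... | inj₂ refl  = trans (inverseʳ-unique S (Y (suc m)) S+Y≡0) (sym (inv-suc a m))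
        where
          S : ℤ
          S = sumTo m (λ j → a (suc m ∸ j) * inv a j)
          S+Y≡0 : S + Y (suc m) ≡ + 0
          S+Y≡0 = begin
            S + Y (suc m)                                                ≡⟨ cong₂ _+_ (sumTo-cong m (λ j j≤m → cong (a (suc m ∸ j) *_) (sym (agree m j j≤m))))
                                                                                     (sym (trans (cong (_* Y (suc m)) a0) (ℤP.*-identityˡ _))) ⟩
            sumTo m (λ j → a (suc m ∸ j) * Y j) + a 0 * Y (suc m)       ≡⟨ sym (mul-last a Y m) ⟩
            (a *ₛ Y) (suc m)                                             ≡⟨ aY (suc m) ⟩
            + 0                                                          ∎

  qPochInv : ℕ → Series
  qPochInv N = inv (qPoch N)

  qPochInv-step : ∀ N → qPochInv (suc N) ≐ (qPochInv N +ₛ shift (suc N) (qPochInv (suc N)))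
  qPochInv-step N n = begin
    I′ n                    ≡⟨ add-back ⟩
    Y n + shift (suc N) I′ n  ≡⟨ cong (_+ shift (suc N) I′ n) (inv-unique Q Y (qPoch-constant N) QY≐1 n) ⟩
    qPochInv N n + shift (suc N) I′ n ∎
    where
      Q I′ Y : Series
      Q = qPoch N
      I′ = qPochInv (suc N)
      -- Y = (1 - q^{N+1}) / (q;q)_{N+1} is an inverse of (q;q)_N, hence equals 1/(q;q)_N.
      Y = I′ -ₛ shift (suc N) I′
      add-back : I′ n ≡ Y n + shift (suc N) I′ n
      add-back = sym (trans (ℤP.+-assoc (I′ n) _ _)
                                (trans (cong (_+_ (I′ n)) (ℤP.+-inverseˡ (shift (suc N) I′ n)))
                                       (ℤP.+-identityʳ (I′ n))))
      QY≐1 : (Q *ₛ Y) ≐ oneS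
      QY≐1 m = begin
        (Q *ₛ Y) m                                        ≡⟨ mul-minusˡ Q I′ (shift (suc N) I′) m ⟩
        (Q *ₛ I′) m - (Q *ₛ shift (suc N) I′) m           ≡⟨ cong (_-_ ((Q *ₛ I′) m)) (trans (mul-shiftʳ (suc N) Q I′ m) (sym (mul-shiftˡ (suc N) Q I′ m))) ⟩
        (Q *ₛ I′) m - (shift (suc N) Q *ₛ I′) m           ≡⟨ sym (mul-minusʳ Q (shift (suc N) Q) I′ m) ⟩
        ((Q -ₛ shift (suc N) Q) *ₛ I′) m                  ≡⟨ sym (mul-congˡ I′ (qPoch-step N) m) ⟩
        (qPoch (suc N) *ₛ I′) m                           ≡⟨ inv-inverse (qPoch (suc N)) (qPoch-constant (suc N)) m ⟩
        oneS m                                            ∎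

  triangle : ℕ → ℕ
  triangle zero    = 0
  triangle (suc N) = suc N ℕ.+ triangle N

  triangle-double : ∀ N → triangle N ℕ.* 2 ≡ N ℕ.* suc N
  triangle-double zero    = refl
  triangle-double (suc N) = begin
    (suc N ℕ.+ triangle N) ℕ.* 2          ≡⟨ ℕP.*-distribʳ-+ 2 (suc N) (triangle N) ⟩
    suc N ℕ.* 2 ℕ.+ triangle N ℕ.* 2      ≡⟨ cong (suc N ℕ.* 2 ℕ.+_) (triangle-double N) ⟩
    suc N ℕ.* 2 ℕ.+ N ℕ.* suc N           ≡⟨ arith N ⟩
    suc N ℕ.* suc (suc N)                 ∎
    where
      arith : ∀ N → suc N ℕ.* 2 ℕ.+ N ℕ.* suc N ≡ suc N ℕ.* suc (suc N)
      arith = ℕS.solve-∀ where import Data.Nat.Tactic.RingSolver as ℕS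

  triangle-formula : ∀ N → N ℕ.* suc N ℕ./ 2 ≡ triangle N
  triangle-formula N = trans (cong (ℕ._/ 2) (sym (triangle-double N))) (m*n/n≡m (triangle N) 2)

  numerator : ℕ → Series
  numerator N = shift (triangle N) (minusPoch N)

  numerator-step : ∀ N → numerator (suc N) ≐ (shift (suc N) (numerator N) +ₛ shift (suc N ℕ.+ N) (numerator N))
  numerator-step N m = begin
    numerator (suc N) m                                                     ≡⟨ shift-cong (triangle (suc N)) (minusPoch-step N) m ⟩
    shift (triangle (suc N)) (P +ₛ shift N P) m                             ≡⟨ shift-+ (triangle (suc N)) P (shift N P) m ⟩
    shift (triangle (suc N)) P m + shift (triangle (suc N)) (shift N P) m   ≡⟨ cong₂ _+_ (sym (shift-shift (suc N) (triangle N) P m)) higher ⟩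
    shift (suc N) (numerator N) m + shift (suc N ℕ.+ N) (numerator N) m     ∎
    where
      P : Series
      P = minusPoch N
      exponent : triangle (suc N) ℕ.+ N ≡ (suc N ℕ.+ N) ℕ.+ triangle N
      exponent = xy∙z≈xz∙y (suc N) (triangle N) N
        where open import Algebra.Properties.CommutativeSemigroup ℕP.+-commutativeSemigroup using (xy∙z≈xz∙y)
      higher : shift (triangle (suc N)) (shift N P) m ≡ shift (suc N ℕ.+ N) (numerator N) m
      higher = begin
        shift (triangle (suc N)) (shift N P) m         ≡⟨ shift-shift (triangle (suc N)) N P m ⟩
        shift (triangle (suc N) ℕ.+ N) P m             ≡⟨ cong (λ t → shift t P m) exponent ⟩
        shift ((suc N ℕ.+ N) ℕ.+ triangle N) P m       ≡⟨ sym (shift-shift (suc N ℕ.+ N) (triangle N) P m) ⟩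
        shift (suc N ℕ.+ N) (numerator N) m            ∎

  summand : ℕ → Series
  summand N = numerator N *ₛ qPochInv N

  term≐summand : ∀ N → term N ≐ summand N
  term≐summand N n = begin
    term N n                                                      ≡⟨ mul-congˡ (qPochInv N) (mul-qPowʳ (N ℕ.* suc N ℕ./ 2) (minusPoch N)) n ⟩
    (shift (N ℕ.* suc N ℕ./ 2) (minusPoch N) *ₛ qPochInv N) n     ≡⟨ cong (λ t → (shift t (minusPoch N) *ₛ qPochInv N) n) (triangle-formula N) ⟩
    summand N n                                                   ∎

  summand-zero : summand 0 ≐ oneS
  summand-zero n =
    trans (mul-comm oneS (inv oneS) n)
          (trans (mul-oneʳ (inv oneS) n) (sym (inv-unique oneS oneS refl (mul-oneʳ oneS) n)))

  summand-step : ∀ N → summand (suc N) ≐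
    ((shift (suc N) (summand (suc N)) +ₛ shift (suc N ℕ.+ N) (summand N)) +ₛ shift (suc N) (summand N))
  summand-step N n = begin
    (S′ *ₛ I′) n                                            ≡⟨ mul-congʳ S′ (qPochInv-step N) n ⟩
    (S′ *ₛ (I +ₛ shift (suc N) I′)) n                       ≡⟨ mul-distribˡ S′ I (shift (suc N) I′) n ⟩
    (S′ *ₛ I) n + (S′ *ₛ shift (suc N) I′) n                ≡⟨ cong₂ _+_ old-part (mul-shiftʳ (suc N) S′ I′ n) ⟩
    (shift (suc N) T n + shift (suc N ℕ.+ N) T n) + shift (suc N) T′ n
                                                            ≡⟨ rotate (shift (suc N) T n) _ _ ⟩
    (shift (suc N) T′ n + shift (suc N ℕ.+ N) T n) + shift (suc N) T n ∎
    where
      I I′ S S′ T T′ : Series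
      I = qPochInv N
      I′ = qPochInv (suc N)
      S = numerator N
      S′ = numerator (suc N)
      T = summand N
      T′ = summand (suc N)
      rotate : ∀ a b c → (a + b) + c ≡ (c + b) + a
      rotate = solve-∀
      old-part : (S′ *ₛ I) n ≡ shift (suc N) T n + shift (suc N ℕ.+ N) T n
      old-part = begin
        (S′ *ₛ I) n                                                 ≡⟨ mul-congˡ I (numerator-step N) n ⟩
        ((shift (suc N) S +ₛ shift (suc N ℕ.+ N) S) *ₛ I) n         ≡⟨ mul-distribʳ (shift (suc N) S) (shift (suc N ℕ.+ N) S) I n ⟩
        (shift (suc N) S *ₛ I) n + (shift (suc N ℕ.+ N) S *ₛ I) n   ≡⟨ cong₂ _+_ (mul-shiftˡ (suc N) S I n) (mul-shiftˡ (suc N ℕ.+ N) S I n) ⟩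
        shift (suc N) T n + shift (suc N ℕ.+ N) T n                 ∎

module Counting where

  open import Data.Bool using (Bool; true; false; not; T)
  open import Data.Empty using (⊥; ⊥-elim)
  open import Data.Fin as Fin using (Fin)
  open import Data.Fin.Properties using (+↔⊎)
  open import Data.Nat as ℕ using (ℕ; zero; suc)
  import Data.Nat.Properties as ℕP
  open import Data.Integer as ℤ using (ℤ; +_)
  open import Data.Product using (Σ; _×_; _,_)
  open import Data.Sum using (_⊎_; inj₁; inj₂)
  open import Data.Sum.Function.Propositional using (_⊎-cong_)
  open import Function.Bundles using (_↔_; mk↔ₛ′; _⇔_; mk⇔; Equivalence)
  open import Function.Properties.Inverse using (↔-refl; ↔-trans; ↔-sym)
  open import Function.Related.TypeIsomorphisms using (Σ-distribˡ-⊎)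
  open import Data.Product.Function.Dependent.Propositional using (Σ-↔)
  open import Relation.Binary.PropositionalEquality
  open import Relation.Nullary using (Irrelevant)
  open PowerSeries using (shift)

  Card : Set → ℤ → Set
  Card X z = Σ ℕ (λ k → (X ↔ Fin k) × (+ k ≡ z))

  card-↔ : ∀ {X Y z} → X ↔ Y → Card Y z → Card X z
  card-↔ X↔Y (k , Y↔k , eq) = k , ↔-trans X↔Y Y↔k , eq

  card-≡ : ∀ {X y z} → y ≡ z → Card X y → Card X z
  card-≡ refl c = c

  card-⊎ : ∀ {X Y x y} → Card X x → Card Y y → Card (X ⊎ Y) (x ℤ.+ y)
  card-⊎ (k , X↔k , ex) (l , Y↔l , ey) =
    k ℕ.+ l , ↔-trans (X↔k ⊎-cong Y↔l) (↔-sym +↔⊎) , cong₂ ℤ._+_ ex ey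

  card-empty : ∀ {X} → (X → ⊥) → Card X (+ 0)
  card-empty ¬x = 0 , mk↔ₛ′ (λ x → ⊥-elim (¬x x)) (λ ()) (λ ()) (λ x → ⊥-elim (¬x x)) , refl

  card-single : ∀ {X} (x : X) → (∀ y → y ≡ x) → Card X (+ 1)
  card-single x unique =
    1 , mk↔ₛ′ (λ _ → Fin.zero) (λ _ → x) (λ { Fin.zero → refl ; (Fin.suc ()) }) (λ y → sym (unique y)) , refl

  ×-irrelevant : ∀ {A B : Set} → Irrelevant A → Irrelevant B → Irrelevant (A × B)
  ×-irrelevant irrA irrB (a , b) (a′ , b′) = cong₂ _,_ (irrA a a′) (irrB b b′)

  Σ-≡ : ∀ {A : Set} {P : A → Set} → (∀ {a} → Irrelevant (P a)) →
        ∀ {a a′ p p′} → a ≡ a′ → _≡_ {A = Σ A P} (a , p) (a′ , p′)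
  Σ-≡ irr {p = p} {p′} refl = cong (_ ,_) (irr p p′)

  Σ-image : ∀ {A B : Set} {P : A → Set} {Q : B → Set} →
    (∀ {a} → Irrelevant (P a)) → (∀ {b} → Irrelevant (Q b)) →
    (f : A → B) (g : B → A) → (∀ b → P (g b) ⇔ Q b) →
    (∀ a → P a → g (f a) ≡ a) → (∀ b → f (g b) ≡ b) → Σ A P ↔ Σ B Q
  Σ-image {P = P} irrP irrQ f g P∘g⇔Q gf fg = mk↔ₛ′
    (λ (a , p) → f a , Equivalence.to (P∘g⇔Q (f a)) (subst P (sym (gf a p)) p))
    (λ (b , q) → g b , Equivalence.from (P∘g⇔Q b) q)
    (λ (b , q) → Σ-≡ irrQ (fg b)) (λ (a , p) → Σ-≡ irrP (gf a p))

  Σ-⇔ : ∀ {A : Set} {P Q : A → Set} → (∀ {a} → Irrelevant (P a)) → (∀ {a} → Irrelevant (Q a)) →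
    (∀ a → P a → Q a) → (∀ a → Q a → P a) → Σ A P ↔ Σ A Q
  Σ-⇔ irrP irrQ to from =
    Σ-image irrP irrQ (λ a → a) (λ a → a) (λ a → mk⇔ (to a) (from a)) (λ _ _ → refl) (λ _ → refl)

  split-by : ∀ {X : Set} (b : Bool) → X ↔ ((X × T b) ⊎ (X × T (not b)))
  split-by true  = mk↔ₛ′ (λ x → inj₁ (x , _)) (λ { (inj₁ (x , _)) → x ; (inj₂ (_ , ())) })
                         (λ { (inj₁ _) → refl ; (inj₂ (_ , ())) }) (λ _ → refl)
  split-by false = mk↔ₛ′ (λ x → inj₂ (x , _)) (λ { (inj₁ (_ , ())) ; (inj₂ (x , _)) → x })
                         (λ { (inj₁ (_ , ())) ; (inj₂ _) → refl }) (λ _ → refl)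

  Σ-split : ∀ {A : Set} {P : A → Set} (c : A → Bool) →
    Σ A P ↔ (Σ A (λ a → P a × T (c a)) ⊎ Σ A (λ a → P a × T (not (c a))))
  Σ-split c = ↔-trans (Σ-↔ ↔-refl (split-by (c _))) Σ-distribˡ-⊎

  Weighted : {A : Set} → (A → Set) → (A → ℕ) → ℕ → ℕ → Set
  Weighted {A} X w s n = Σ A (λ a → X a × s ℕ.+ w a ≡ n)

  -- Offsetting weights by s multiplies the generating function by q^s.
  card-shift : ∀ {A : Set} {X : A → Set} {w F} s n →
    (∀ m → s ℕ.+ m ≡ n → Card (Weighted X w 0 m) (F m)) → Card (Weighted X w s n) (shift s F n)
  card-shift zero    n       count = count n refl
  card-shift (suc s) zero    count = card-empty (λ { (_ , _ , ()) })
  card-shift {X = X} {w} (suc s) (suc n) count =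
    card-↔ drop-suc (card-shift s n (λ m e → count m (cong suc e)))
    where
      drop-suc : Weighted X w (suc s) (suc n) ↔ Weighted X w s n
      drop-suc = mk↔ₛ′ (λ (a , x , e) → a , x , ℕP.suc-injective e) (λ (a , x , e) → a , x , cong suc e)
        (λ (a , x , e) → cong (λ e′ → a , x , e′) (ℕP.≡-irrelevant _ _))
        (λ (a , x , e) → cong (λ e′ → a , x , e′) (ℕP.≡-irrelevant _ _))

module Lists where

  open import Algebra.Bundles using (CommutativeMonoid)
  open import Data.Bool using (Bool; true; false; _∧_; not; T)
  open import Data.Bool.Properties using (∧-assoc; ∧-identityʳ; ∧-commutativeMonoid; T-∧)
  open import Data.Bool.ListAction using (all)
  open import Data.Empty using (⊥)
  open import Data.List using (List; []; _∷_; [_]; map; length; _∷ʳ_)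
  open import Data.List.Properties using (map-∘; map-id; length-++)
  open import Data.Nat as ℕ using (ℕ; zero; suc; pred; _≤_; _≤ᵇ_; _<ᵇ_)
  import Data.Nat.Properties as ℕP
  open import Data.Nat.ListAction using (sum)
  open import Data.Nat.ListAction.Properties using (sum-++)
  open import Data.Product using (_×_; _,_; proj₁; proj₂)
  open import Function.Bundles using (Equivalence)
  open import Relation.Binary.PropositionalEquality hiding ([_])
  open ≡-Reasoning

  ∧-intro : ∀ {a b} → T a → T b → T (a ∧ b)
  ∧-intro ta tb = Equivalence.from T-∧ (ta , tb)

  ∧-elim : ∀ {a b} → T (a ∧ b) → T a × T b
  ∧-elim = Equivalence.to T-∧

  not-intro : ∀ {b} → (T b → ⊥) → T (not b)
  not-intro {false} _  = _
  not-intro {true}  ¬t = ¬t _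

  not-elim : ∀ {b} → T (not b) → T b → ⊥
  not-elim {false} _ ()

  pairwise : (ℕ → ℕ → Bool) → List ℕ → Bool
  pairwise r []       = true
  pairwise r (x ∷ xs) = all (r x) xs ∧ pairwise r xs

  decreasing : List ℕ → Bool
  decreasing = pairwise (λ x y → y <ᵇ x)

  nonIncreasing : List ℕ → Bool
  nonIncreasing = pairwise (λ x y → y ≤ᵇ x)

  all-∷⁻ : ∀ {p : ℕ → Bool} x xs → T (all p (x ∷ xs)) → T (p x) × T (all p xs)
  all-∷⁻ {p} x xs = ∧-elim {p x}

  pairwise-∷⁻ : ∀ {r : ℕ → ℕ → Bool} x xs → T (pairwise r (x ∷ xs)) → T (all (r x) xs) × T (pairwise r xs)
  pairwise-∷⁻ {r} x xs = ∧-elim {all (r x) xs}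

  all-mono : ∀ {p q : ℕ → Bool} → (∀ x → T (p x) → T (q x)) → ∀ xs → T (all p xs) → T (all q xs)
  all-mono p⇒q []       _ = _
  all-mono p⇒q (x ∷ xs) t = let (px , ps) = all-∷⁻ x xs t in ∧-intro (p⇒q x px) (all-mono p⇒q xs ps)

  atLeast-mono : ∀ {j k} → j ≤ k → ∀ xs → T (all (k ≤ᵇ_) xs) → T (all (j ≤ᵇ_) xs)
  atLeast-mono {j} {k} j≤k = all-mono (λ x k≤x → ℕP.≤⇒≤ᵇ (ℕP.≤-trans j≤k (ℕP.≤ᵇ⇒≤ k x k≤x)))

  pairwise-mono : ∀ {r s : ℕ → ℕ → Bool} → (∀ x y → T (r x y) → T (s x y)) →
                  ∀ xs → T (pairwise r xs) → T (pairwise s xs)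
  pairwise-mono r⇒s []       _ = _
  pairwise-mono r⇒s (x ∷ xs) t =
    let (rx , rs) = pairwise-∷⁻ x xs t in ∧-intro (all-mono (r⇒s x) xs rx) (pairwise-mono r⇒s xs rs)

  decreasing⇒nonIncreasing : ∀ xs → T (decreasing xs) → T (nonIncreasing xs)
  decreasing⇒nonIncreasing =
    pairwise-mono (λ x y y<x → ℕP.≤⇒≤ᵇ (ℕP.<⇒≤ (ℕP.<ᵇ⇒< y x y<x)))

  all-∷ʳ : ∀ (p : ℕ → Bool) xs x → all p (xs ∷ʳ x) ≡ (all p xs ∧ p x)
  all-∷ʳ p []       x = ∧-identityʳ (p x)
  all-∷ʳ p (y ∷ xs) x =
    trans (cong (p y ∧_) (all-∷ʳ p xs x)) (sym (∧-assoc (p y) (all p xs) (p x)))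

  pairwise-∷ʳ : ∀ r xs y → pairwise r (xs ∷ʳ y) ≡ (pairwise r xs ∧ all (λ x → r x y) xs)
  pairwise-∷ʳ r []       y = refl
  pairwise-∷ʳ r (x ∷ xs) y = begin
    all (r x) (xs ∷ʳ y) ∧ pairwise r (xs ∷ʳ y)
      ≡⟨ cong₂ _∧_ (all-∷ʳ (r x) xs y) (pairwise-∷ʳ r xs y) ⟩
    (all (r x) xs ∧ r x y) ∧ (pairwise r xs ∧ all (λ z → r z y) xs)
      ≡⟨ interchange (all (r x) xs) (r x y) (pairwise r xs) _ ⟩
    (all (r x) xs ∧ pairwise r xs) ∧ (r x y ∧ all (λ z → r z y) xs) ∎
    where
      open import Algebra.Properties.CommutativeSemigroup
        (CommutativeMonoid.commutativeSemigroup ∧-commutativeMonoid) using (interchange)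

  all-∷ʳ-fails : ∀ (p : ℕ → Bool) xs x → T (not (p x)) → T (not (all p (xs ∷ʳ x)))
  all-∷ʳ-fails p xs x ¬px =
    not-intro (λ t → not-elim ¬px (proj₂ (∧-elim (subst T (all-∷ʳ p xs x) t))))

  length-∷ʳ : ∀ (xs : List ℕ) x → length (xs ∷ʳ x) ≡ suc (length xs)
  length-∷ʳ xs x = trans (length-++ xs) (ℕP.+-comm (length xs) 1)

  sum-∷ʳ : ∀ xs x → sum (xs ∷ʳ x) ≡ sum xs ℕ.+ x
  sum-∷ʳ xs x = trans (sum-++ xs [ x ]) (cong (sum xs ℕ.+_) (ℕP.+-identityʳ x))

  dropLast : List ℕ → List ℕ
  dropLast []           = []
  dropLast (x ∷ [])     = []
  dropLast (x ∷ y ∷ ys) = x ∷ dropLast (y ∷ ys)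

  dropLast-∷ʳ : ∀ xs x → dropLast (xs ∷ʳ x) ≡ xs
  dropLast-∷ʳ []           x = refl
  dropLast-∷ʳ (y ∷ [])     x = refl
  dropLast-∷ʳ (y ∷ z ∷ zs) x = cong (y ∷_) (dropLast-∷ʳ (z ∷ zs) x)

  last-minimum : ∀ k xs → T (nonIncreasing xs) → T (all (k ≤ᵇ_) xs) →
                 T (not (all (suc k ≤ᵇ_) xs)) → dropLast xs ∷ʳ k ≡ xs
  last-minimum k (x ∷ []) _ k≤x ¬k<x =
    cong [_] (ℕP.≤-antisym (ℕP.≤ᵇ⇒≤ k x (proj₁ (all-∷⁻ {k ≤ᵇ_} x [] k≤x)))
                           (ℕP.≮⇒≥ (λ k<x → not-elim ¬k<x (∧-intro {b = true} (ℕP.≤⇒≤ᵇ k<x) _))))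
  last-minimum k (x ∷ y ∷ ys) ni k≤ ¬k< =
    let (x-bound , ni′) = pairwise-∷⁻ {λ a b → b ≤ᵇ a} x (y ∷ ys) ni
        y≤x = ℕP.≤ᵇ⇒≤ y x (proj₁ (all-∷⁻ {_≤ᵇ x} y ys x-bound))
        -- if every later entry exceeded k, so would x ≥ y
        ¬k<tail = not-intro λ k<tail → not-elim ¬k< (∧-intro
          (ℕP.≤⇒≤ᵇ (ℕP.≤-trans (ℕP.≤ᵇ⇒≤ (suc k) y (proj₁ (all-∷⁻ {suc k ≤ᵇ_} y ys k<tail))) y≤x)) k<tail)
    in cong (x ∷_) (last-minimum k (y ∷ ys) ni′ (proj₂ (all-∷⁻ {k ≤ᵇ_} x (y ∷ ys) k≤)) ¬k<tail)

  ≤ᵇ-suc : ∀ m n → (suc m ≤ᵇ suc n) ≡ (m ≤ᵇ n)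
  ≤ᵇ-suc zero    n = refl
  ≤ᵇ-suc (suc m) n = refl

  all-raise : ∀ {p q : ℕ → Bool} → (∀ x → p (suc x) ≡ q x) → ∀ xs → all p (map suc xs) ≡ all q xs
  all-raise e []       = refl
  all-raise e (x ∷ xs) = cong₂ _∧_ (e x) (all-raise e xs)

  pairwise-raise : ∀ {r : ℕ → ℕ → Bool} → (∀ x y → r (suc x) (suc y) ≡ r x y) →
                   ∀ xs → pairwise r (map suc xs) ≡ pairwise r xs
  pairwise-raise e []       = refl
  pairwise-raise e (x ∷ xs) = cong₂ _∧_ (all-raise (e x) xs) (pairwise-raise e xs)

  raised-positive : ∀ xs → T (all (1 ≤ᵇ_) (map suc xs))
  raised-positive []       = _
  raised-positive (x ∷ xs) = raised-positive xs

  sum-raise : ∀ xs → sum (map suc xs) ≡ length xs ℕ.+ sum xs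
  sum-raise []       = refl
  sum-raise (x ∷ xs) = cong suc (trans (cong (x ℕ.+_) (sum-raise xs)) (x∙yz≈y∙xz x (length xs) (sum xs)))
    where open import Algebra.Properties.CommutativeSemigroup ℕP.+-commutativeSemigroup using (x∙yz≈y∙xz)

  raise-lower : ∀ xs → T (all (1 ≤ᵇ_) xs) → map suc (map pred xs) ≡ xs
  raise-lower []           _ = refl
  raise-lower (suc x ∷ xs) t = cong (suc x ∷_) (raise-lower xs (proj₂ (all-∷⁻ (suc x) xs t)))

  lower-raise : ∀ xs → map pred (map suc xs) ≡ xs
  lower-raise xs = trans (sym (map-∘ xs)) (map-id xs)

module Pairs where

  open import Data.Bool using (Bool; true; _∧_; not; T)
  open import Data.Bool.Properties using (T-irrelevant)
  open import Data.Bool.ListAction using (all)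
  open import Data.Empty using (⊥)
  open import Data.List using (List; []; _∷_; map; length; _∷ʳ_)
  open import Data.List.Properties using (length-map)
  open import Data.Nat as ℕ using (ℕ; zero; suc; pred; _+_; _<_; _≤ᵇ_)
  import Data.Nat.Properties as ℕP
  open import Data.Nat.Induction using (<-rec)
  open import Data.Nat.ListAction using (sum)
  open import Data.Product using (Σ; _×_; _,_; proj₁; proj₂)
  open import Data.Sum using (_⊎_)
  open import Data.Sum.Function.Propositional using (_⊎-cong_)
  open import Function.Bundles using (_↔_; _⇔_; mk⇔; Equivalence)
  open import Function.Properties.Inverse using (↔-trans; ↔-refl)
  open import Relation.Binary.PropositionalEquality
  open import Relation.Nullary using (Irrelevant)
  open Lists
  open Counting
  open PowerSeries using (shift; summand; summand-zero; summand-step)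

  -- An overpartition, split into the values of its overlined parts and of
  -- its non-overlined parts.
  Pair : Set
  Pair = List ℕ × List ℕ

  size : Pair → ℕ
  size (O , P) = length O + length P

  pairWeight : Pair → ℕ
  pairWeight (O , P) = sum O + sum P

  record Admissible (b : ℕ) (x : Pair) : Set where
    constructor admissible
    field
      distinct : T (decreasing (proj₁ x))
      positive : T (all (1 ≤ᵇ_) (proj₁ x))
      ordered  : T (nonIncreasing (proj₂ x))
      bounded  : T (all (b ≤ᵇ_) (proj₂ x))

  Admissible-irrelevant : ∀ {b x} → Irrelevant (Admissible b x)
  Admissible-irrelevant (admissible d p o b) (admissible d′ p′ o′ b′)
    rewrite T-irrelevant d d′ | T-irrelevant p p′ | T-irrelevant o o′ | T-irrelevant b b′ = refl

  Shape : ℕ → ℕ → Pair → Set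
  Shape b k x = Admissible b x × size x ≡ k

  -- The pairs counted by c(N, n ∸ s): N parts, non-overlined parts ≥ N, and
  -- weight w with s + w = n.
  Obj : ℕ → ℕ → ℕ → Set
  Obj N = Weighted (Shape N N) pairWeight

  weighted-irrelevant : ∀ {b k s n x} → Irrelevant (Shape b k x × s + pairWeight x ≡ n)
  weighted-irrelevant = ×-irrelevant (×-irrelevant Admissible-irrelevant ℕP.≡-irrelevant) ℕP.≡-irrelevant

  noOverlinedOne : Pair → Bool
  noOverlinedOne (O , P) = all (2 ≤ᵇ_) O

  plainAbove : ℕ → Pair → Bool
  plainAbove b (O , P) = all (suc b ≤ᵇ_) P

  -- Removing the first column of the diagram (subtracting 1 from every part)
  -- and adding it back.

  raise : Pair → Pair
  raise (O , P) = map suc O , map suc P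

  lower : Pair → Pair
  lower (O , P) = map pred O , map pred P

  raise-admissible : ∀ b y → Admissible b y ⇔ (Admissible (suc b) (raise y) × T (noOverlinedOne (raise y)))
  raise-admissible b (O , P) = mk⇔ to from
    where
      distinct-raise : decreasing (map suc O) ≡ decreasing O
      distinct-raise = pairwise-raise (λ _ _ → refl) O
      ordered-raise : nonIncreasing (map suc P) ≡ nonIncreasing P
      ordered-raise = pairwise-raise (λ x y → ≤ᵇ-suc y x) P
      bound-raise : all (suc b ≤ᵇ_) (map suc P) ≡ all (b ≤ᵇ_) P
      bound-raise = all-raise (≤ᵇ-suc b) P
      one-raise : all (2 ≤ᵇ_) (map suc O) ≡ all (1 ≤ᵇ_) O
      one-raise = all-raise (≤ᵇ-suc 1) O
      to : Admissible b (O , P) → Admissible (suc b) (raise (O , P)) × T (noOverlinedOne (raise (O , P)))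
      to (admissible d p o bd) =
        admissible (subst T (sym distinct-raise) d) (raised-positive O)
                   (subst T (sym ordered-raise) o) (subst T (sym bound-raise) bd)
        , subst T (sym one-raise) p
      from : Admissible (suc b) (raise (O , P)) × T (noOverlinedOne (raise (O , P))) → Admissible b (O , P)
      from (admissible d _ o bd , no1) =
        admissible (subst T distinct-raise d) (subst T one-raise no1) (subst T ordered-raise o) (subst T bound-raise bd)

  raise-size : ∀ y → size (raise y) ≡ size y
  raise-size (O , P) = cong₂ _+_ (length-map suc O) (length-map suc P)

  raise-weight : ∀ y → pairWeight (raise y) ≡ size y + pairWeight y
  raise-weight (O , P) =
    trans (cong₂ _+_ (sum-raise O) (sum-raise P)) (interchange (length O) (sum O) (length P) (sum P))
    where open import Algebra.Properties.CommutativeSemigroup ℕP.+-commutativeSemigroup using (interchange)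

  raise-lower-pair : ∀ {b} x → Admissible (suc b) x → T (noOverlinedOne x) → raise (lower x) ≡ x
  raise-lower-pair (O , P) adm no1 =
    cong₂ _,_ (raise-lower O (atLeast-mono (ℕ.s≤s ℕ.z≤n) O no1))
              (raise-lower P (atLeast-mono (ℕ.s≤s ℕ.z≤n) P (Admissible.bounded adm)))

  lower-raise-pair : ∀ y → lower (raise y) ≡ y
  lower-raise-pair (O , P) = cong₂ _,_ (lower-raise O) (lower-raise P)

  column-↔ : ∀ b k s n →
    Σ Pair (λ x → (Shape (suc b) k x × s + pairWeight x ≡ n) × T (noOverlinedOne x)) ↔
    Weighted (Shape b k) pairWeight (s + k) n
  column-↔ b k s n =
    Σ-image (×-irrelevant (weighted-irrelevant {s = s} {n}) T-irrelevant) (weighted-irrelevant {s = s + k} {n})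
            lower raise lowered
            (λ x (((adm , _) , _) , no1) → raise-lower-pair x adm no1) lower-raise-pair
    where
      weight-shift : ∀ y → size y ≡ k → s + pairWeight (raise y) ≡ (s + k) + pairWeight y
      weight-shift y sz = trans (cong (s +_) (trans (raise-weight y) (cong (_+ pairWeight y) sz)))
                                (sym (ℕP.+-assoc s k (pairWeight y)))
      lowered : ∀ y → ((Shape (suc b) k (raise y) × s + pairWeight (raise y) ≡ n) × T (noOverlinedOne (raise y)))
                      ⇔ (Shape b k y × (s + k) + pairWeight y ≡ n)
      lowered y = mk⇔
        (λ (((adm , sz) , wt) , no1) →
           let sz′ = trans (sym (raise-size y)) sz
           in (Equivalence.from (raise-admissible b y) (adm , no1) , sz′) , trans (sym (weight-shift y sz′)) wt)
        (λ ((adm , sz) , wt) →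
           let (adm′ , no1) = Equivalence.to (raise-admissible b y) adm
           in ((adm′ , trans (raise-size y) sz) , trans (weight-shift y sz) wt) , no1)

  append-one-admissible : ∀ b O P → Admissible b (O ∷ʳ 1 , P) ⇔ (Admissible b (O , P) × T (all (2 ≤ᵇ_) O))
  append-one-admissible b O P = mk⇔
    (λ (admissible d p o bd) →
       let (d′ , two) = ∧-elim (subst T distinct-∷ʳ d)
       in admissible d′ (proj₁ (∧-elim (subst T positive-∷ʳ p))) o bd , two)
    (λ (admissible d p o bd , two) →
       admissible (subst T (sym distinct-∷ʳ) (∧-intro d two)) (subst T (sym positive-∷ʳ) (∧-intro p _)) o bd)
    where
      distinct-∷ʳ : decreasing (O ∷ʳ 1) ≡ (decreasing O ∧ all (2 ≤ᵇ_) O)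
      distinct-∷ʳ = pairwise-∷ʳ _ O 1
      positive-∷ʳ : all (1 ≤ᵇ_) (O ∷ʳ 1) ≡ (all (1 ≤ᵇ_) O ∧ true)
      positive-∷ʳ = all-∷ʳ _ O 1

  append-min-admissible : ∀ b O P → Admissible b (O , P ∷ʳ b) ⇔ Admissible b (O , P)
  append-min-admissible b O P = mk⇔
    (λ (admissible d p o bd) →
       admissible d p (proj₁ (∧-elim (subst T ordered-∷ʳ o))) (proj₁ (∧-elim (subst T bounded-∷ʳ bd))))
    (λ (admissible d p o bd) →
       admissible d p (subst T (sym ordered-∷ʳ) (∧-intro o bd))
                      (subst T (sym bounded-∷ʳ) (∧-intro bd (ℕP.≤⇒≤ᵇ (ℕP.≤-refl {b})))))
    where
      ordered-∷ʳ : nonIncreasing (P ∷ʳ b) ≡ (nonIncreasing P ∧ all (b ≤ᵇ_) P)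
      ordered-∷ʳ = pairwise-∷ʳ _ P b
      bounded-∷ʳ : all (b ≤ᵇ_) (P ∷ʳ b) ≡ (all (b ≤ᵇ_) P ∧ (b ≤ᵇ b))
      bounded-∷ʳ = all-∷ʳ _ P b

  Counted : ℕ → ℕ → Pair → Set
  Counted N n x = Shape N N x × pairWeight x ≡ n

  KindA KindB KindC : ℕ → ℕ → Set
  KindA N n = Σ Pair (λ x → (Counted (suc N) n x × T (noOverlinedOne x)) × T (plainAbove (suc N) x))
  KindB N n = Σ Pair (λ x → (Counted (suc N) n x × T (noOverlinedOne x)) × T (not (plainAbove (suc N) x)))
  KindC N n = Σ Pair (λ x → Counted (suc N) n x × T (not (noOverlinedOne x)))

  sort : ∀ N n → Obj (suc N) 0 n ↔ ((KindA N n ⊎ KindB N n) ⊎ KindC N n)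
  sort N n = ↔-trans (Σ-split noOverlinedOne) (Σ-split (plainAbove (suc N)) ⊎-cong ↔-refl)

  reduce-a : ∀ N n → KindA N n ↔ Obj (suc N) (suc N) n
  reduce-a N n = ↔-trans strengthened (column-↔ (suc N) (suc N) 0 n)
    where
      -- no overlined 1 and all non-overlined parts > N+1 is admissibility for the bound N+2
      strengthened : KindA N n ↔ Σ Pair (λ x → (Shape (suc (suc N)) (suc N) x × 0 + pairWeight x ≡ n) × T (noOverlinedOne x))
      strengthened = Σ-⇔ (×-irrelevant (×-irrelevant (weighted-irrelevant {s = 0}) T-irrelevant) T-irrelevant)
                         (×-irrelevant (weighted-irrelevant {s = 0}) T-irrelevant)
        (λ { (O , P) ((((admissible d p o bd , sz) , wt) , no1) , above) → ((admissible d p o above , sz) , wt) , no1 })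
        (λ { (O , P) (((admissible d p o bd , sz) , wt) , no1) →
               (((admissible d p o (atLeast-mono (ℕP.n≤1+n (suc N)) P bd) , sz) , wt) , no1) , bd })

  reduce-b : ∀ N n → KindB N n ↔ Obj N (suc N + N) n
  reduce-b N n = ↔-trans (Σ-image (×-irrelevant (×-irrelevant (weighted-irrelevant {s = 0}) T-irrelevant) T-irrelevant)
                                  (×-irrelevant (weighted-irrelevant {s = suc N}) T-irrelevant)
                                  dropMin addMin added restore (λ (O , P) → cong (O ,_) (dropLast-∷ʳ P (suc N))))
                         (column-↔ N N (suc N) n)
    where
      addMin dropMin : Pair → Pair
      addMin (O , P) = O , P ∷ʳ suc N
      dropMin (O , P) = O , dropLast P
      size-addMin : ∀ y → size (addMin y) ≡ suc (size y)
      size-addMin (O , P) = trans (cong (length O +_) (length-∷ʳ P (suc N))) (ℕP.+-suc (length O) (length P))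
      weight-addMin : ∀ y → pairWeight (addMin y) ≡ suc N + pairWeight y
      weight-addMin (O , P) = trans (cong (sum O +_) (trans (sum-∷ʳ P (suc N)) (ℕP.+-comm (sum P) (suc N))))
                                    (x∙yz≈y∙xz (sum O) (suc N) (sum P))
        where open import Algebra.Properties.CommutativeSemigroup ℕP.+-commutativeSemigroup using (x∙yz≈y∙xz)
      not-above : ∀ P → T (not (all (suc (suc N) ≤ᵇ_) (P ∷ʳ suc N)))
      not-above P = all-∷ʳ-fails _ P (suc N) (not-intro (λ t → ℕP.n≮n (suc N) (ℕP.≤ᵇ⇒≤ (suc (suc N)) (suc N) t)))
      added : ∀ y → ((Counted (suc N) n (addMin y) × T (noOverlinedOne (addMin y))) × T (not (plainAbove (suc N) (addMin y))))
                    ⇔ ((Shape (suc N) N y × suc N + pairWeight y ≡ n) × T (noOverlinedOne y))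
      added (O , P) = mk⇔
        (λ ((((adm , sz) , wt) , no1) , _) →
           ((Equivalence.to (append-min-admissible (suc N) O P) adm ,
             ℕP.suc-injective (trans (sym (size-addMin (O , P))) sz)) ,
            trans (sym (weight-addMin (O , P))) wt) , no1)
        (λ (((adm , sz) , wt) , no1) →
           (((Equivalence.from (append-min-admissible (suc N) O P) adm ,
              trans (size-addMin (O , P)) (cong suc sz)) , trans (weight-addMin (O , P)) wt) , no1) ,
           not-above P)
      restore : ∀ x → (Counted (suc N) n x × T (noOverlinedOne x)) × T (not (plainAbove (suc N) x)) →
                addMin (dropMin x) ≡ x
      restore (O , P) ((((adm , _) , _) , _) , min) =
        cong (O ,_) (last-minimum (suc N) P (Admissible.ordered adm) (Admissible.bounded adm) min)

  reduce-c : ∀ N n → KindC N n ↔ Obj N (suc N) n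
  reduce-c N n = ↔-trans (Σ-image (×-irrelevant (weighted-irrelevant {s = 0}) T-irrelevant)
                                  (×-irrelevant (weighted-irrelevant {s = 1}) T-irrelevant)
                                  dropOne addOne added restore (λ (O , P) → cong (_, P) (dropLast-∷ʳ O 1)))
                         (column-↔ N N 1 n)
    where
      addOne dropOne : Pair → Pair
      addOne (O , P) = O ∷ʳ 1 , P
      dropOne (O , P) = dropLast O , P
      size-addOne : ∀ y → size (addOne y) ≡ suc (size y)
      size-addOne (O , P) = cong (_+ length P) (length-∷ʳ O 1)
      weight-addOne : ∀ y → pairWeight (addOne y) ≡ suc (pairWeight y)
      weight-addOne (O , P) = cong (_+ sum P) (trans (sum-∷ʳ O 1) (ℕP.+-comm (sum O) 1))
      added : ∀ y → (Counted (suc N) n (addOne y) × T (not (noOverlinedOne (addOne y))))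
                    ⇔ ((Shape (suc N) N y × 1 + pairWeight y ≡ n) × T (noOverlinedOne y))
      added (O , P) = mk⇔
        (λ (((adm , sz) , wt) , _) →
           let (adm′ , no1) = Equivalence.to (append-one-admissible (suc N) O P) adm
           in ((adm′ , ℕP.suc-injective (trans (sym (size-addOne (O , P))) sz)) ,
               trans (sym (weight-addOne (O , P))) wt) , no1)
        (λ (((adm , sz) , wt) , no1) →
           ((Equivalence.from (append-one-admissible (suc N) O P) (adm , no1) ,
             trans (size-addOne (O , P)) (cong suc sz)) , trans (weight-addOne (O , P)) wt) ,
           all-∷ʳ-fails (2 ≤ᵇ_) O 1 _)
      restore : ∀ x → Counted (suc N) n x × T (not (noOverlinedOne x)) → addOne (dropOne x) ≡ x
      restore (O , P) (((adm , _) , _) , one) =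
        cong (_, P) (last-minimum 1 O (decreasing⇒nonIncreasing O (Admissible.distinct adm)) (Admissible.positive adm) one)

  size-zero : ∀ x → size x ≡ 0 → x ≡ ([] , [])
  size-zero ([] , [])    _ = refl
  size-zero ([] , _ ∷ _) ()
  size-zero (_ ∷ _ , _)  ()

  count-zero : ∀ n → Card (Obj 0 0 n) (oneS n)
  count-zero zero    = card-single (([] , []) , (admissible _ _ _ _ , refl) , refl)
                                   (λ (x , (_ , sz) , _) → Σ-≡ (weighted-irrelevant {s = 0}) (size-zero x sz))
  count-zero (suc n) = card-empty no-pair
    where
      no-pair : Obj 0 0 (suc n) → ⊥
      no-pair (x , (_ , sz) , wt) with refl ← size-zero x sz with () ← wt

  count : ∀ n N → Card (Obj N 0 n) (summand N n)
  count = <-rec (λ n → ∀ N → Card (Obj N 0 n) (summand N n)) step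
    where
      step : ∀ n → (∀ {m} → m < n → ∀ N → Card (Obj N 0 m) (summand N m)) →
             ∀ N → Card (Obj N 0 n) (summand N n)
      step n smaller zero    = card-≡ (sym (summand-zero n)) (count-zero n)
      step n smaller (suc N) =
        card-≡ (sym (summand-step N n))
          (card-↔ (sort N n)
            (card-⊎ (card-⊎ (card-↔ (reduce-a N n) (offset (suc N) N))
                            (card-↔ (reduce-b N n) (offset N (N + N))))
                    (card-↔ (reduce-c N n) (offset N N))))
        where
          offset : ∀ M s → Card (Obj M (suc s) n) (shift (suc s) (summand M) n)
          offset M s = card-shift {F = summand M} (suc s) n
            (λ m e → smaller (subst (suc m ℕ.≤_) e (ℕ.s≤s (ℕP.m≤n+m m s))) M)

-- Overpartitions correspond to pairs: splitting into overlined and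
-- non-overlined parts is inverse to merging, and the Durfee condition
-- N = D becomes a lower bound on the non-overlined parts.
module Overpartitions where

  open import Data.Bool using (Bool; true; false; _∧_; not; if_then_else_; T)
  open import Data.Bool.Properties using (T-≡; T-not-≡; T-irrelevant; if-float)
  open import Data.Bool.ListAction using (all)
  open import Data.Empty using (⊥-elim)
  open import Data.List using (List; []; _∷_; length)
  open import Data.Nat as ℕ using (ℕ; zero; suc; _+_; _≤_; _<_; _≤ᵇ_; _<ᵇ_; _≡ᵇ_; z≤n; s≤s)
  import Data.Nat.Properties as ℕP
  open import Data.Nat.ListAction using (sum)
  open import Data.Product using (Σ; _×_; _,_; proj₁; proj₂)
  open import Function.Bundles using (_↔_; _⇔_; mk⇔; Equivalence)
  open import Function.Properties.Equivalence using () renaming (trans to ⇔-trans)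
  open import Relation.Binary.PropositionalEquality
  open import Relation.Nullary using (Irrelevant)
  open Lists
  open Pairs using (Pair; size; pairWeight; Admissible; admissible; Admissible-irrelevant)
  open Counting using (×-irrelevant; Σ-image)

  overlined : List Part → List ℕ
  overlined []                = []
  overlined ((a , true)  ∷ α) = a ∷ overlined α
  overlined ((a , false) ∷ α) = overlined α

  plain : List Part → List ℕ
  plain []                = []
  plain ((a , true)  ∷ α) = plain α
  plain ((a , false) ∷ α) = a ∷ plain α

  parts : List Part → Pair
  parts α = overlined α , plain α

  -- Interleave overlined parts O and non-overlined parts P in non-increasing
  -- order, an overlined part coming first among parts of equal value.
  merge : List ℕ → List ℕ → List Part
  merge []      []      = []
  merge []      (p ∷ P) = (p , false) ∷ merge [] P
  merge (o ∷ O) []      = (o , true) ∷ merge O []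
  merge (o ∷ O) (p ∷ P) = if p ≤ᵇ o then (o , true) ∷ merge O (p ∷ P) else (p , false) ∷ merge (o ∷ O) P

  if-both : ∀ {A : Set} b {x y z : A} → x ≡ z → y ≡ z → (if b then x else y) ≡ z
  if-both true  x≡z _   = x≡z
  if-both false _   y≡z = y≡z

  overlined-merge : ∀ O P → overlined (merge O P) ≡ O
  overlined-merge []      []      = refl
  overlined-merge []      (p ∷ P) = overlined-merge [] P
  overlined-merge (o ∷ O) []      = cong (o ∷_) (overlined-merge O [])
  overlined-merge (o ∷ O) (p ∷ P) = trans (if-float overlined (p ≤ᵇ o))
    (if-both (p ≤ᵇ o) (cong (o ∷_) (overlined-merge O (p ∷ P))) (overlined-merge (o ∷ O) P))

  plain-merge : ∀ O P → plain (merge O P) ≡ P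
  plain-merge []      []      = refl
  plain-merge []      (p ∷ P) = cong (p ∷_) (plain-merge [] P)
  plain-merge (o ∷ O) []      = plain-merge O []
  plain-merge (o ∷ O) (p ∷ P) = trans (if-float plain (p ≤ᵇ o))
    (if-both (p ≤ᵇ o) (plain-merge O (p ∷ P)) (cong (p ∷_) (plain-merge (o ∷ O) P)))

  parts-merge : ∀ O P → parts (merge O P) ≡ (O , P)
  parts-merge O P = cong₂ _,_ (overlined-merge O P) (plain-merge O P)

  weight-parts : ∀ α → weight α ≡ pairWeight (parts α)
  weight-parts []                = refl
  weight-parts ((a , true)  ∷ α) = trans (cong (a +_) (weight-parts α)) (sym (ℕP.+-assoc a _ _))
  weight-parts ((a , false) ∷ α) = trans (cong (a +_) (weight-parts α)) (x∙yz≈y∙xz a (sum (overlined α)) _)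
    where open import Algebra.Properties.CommutativeSemigroup ℕP.+-commutativeSemigroup using (x∙yz≈y∙xz)

  length-parts : ∀ α → length α ≡ size (parts α)
  length-parts []                = refl
  length-parts ((a , true)  ∷ α) = cong suc (length-parts α)
  length-parts ((a , false) ∷ α) = trans (cong suc (length-parts α)) (sym (ℕP.+-suc _ _))

  positive-parts : ∀ α → T (allPositive α) ⇔ (T (all (1 ≤ᵇ_) (overlined α)) × T (all (1 ≤ᵇ_) (plain α)))
  positive-parts α = mk⇔ (to α) (from α)
    where
      to : ∀ α → T (allPositive α) → T (all (1 ≤ᵇ_) (overlined α)) × T (all (1 ≤ᵇ_) (plain α))
      to []                _ = _ , _
      to ((a , true)  ∷ α) t = let (pa , pα) = ∧-elim {1 ≤ᵇ a} t ; (o , p) = to α pα in ∧-intro pa o , p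
      to ((a , false) ∷ α) t = let (pa , pα) = ∧-elim {1 ≤ᵇ a} t ; (o , p) = to α pα in o , ∧-intro pa p
      from : ∀ α → T (all (1 ≤ᵇ_) (overlined α)) × T (all (1 ≤ᵇ_) (plain α)) → T (allPositive α)
      from []                _       = _
      from ((a , true)  ∷ α) (o , p) = let (pa , o′) = all-∷⁻ {1 ≤ᵇ_} a (overlined α) o in ∧-intro pa (from α (o′ , p))
      from ((a , false) ∷ α) (o , p) = let (pa , p′) = all-∷⁻ {1 ≤ᵇ_} a (plain α) p in ∧-intro pa (from α (o , p′))

  private
    overlined-step : ∀ a b → b < a → T (if a ≡ᵇ b then not true else true)
    overlined-step a b b<a with a ≡ᵇ b in eq
    ... | true  = ℕP.<-irrefl (sym (ℕP.≡ᵇ⇒≡ a b (subst T (sym eq) _))) b<a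
    ... | false = _

    overlined-step⁻ : ∀ a b → b ≤ a → T (if a ≡ᵇ b then not true else true) → b < a
    overlined-step⁻ a b b≤a test with a ≡ᵇ b in eq
    ... | false = ℕP.≤∧≢⇒< b≤a (λ b≡a → subst T eq (ℕP.≡⇒≡ᵇ a b (sym b≡a)))

    plain-step : ∀ c → T (if c then not false else true)
    plain-step true  = _
    plain-step false = _

    unpack : ∀ a f b g γ → T (wellOrdered ((a , f) ∷ (b , g) ∷ γ)) →
             b ≤ a × T (if a ≡ᵇ b then not g else true) × T (wellOrdered ((b , g) ∷ γ))
    unpack a f b g γ t =
      let (b≤a , rest) = ∧-elim {b ≤ᵇ a} t
          (test , t′)  = ∧-elim {if a ≡ᵇ b then not g else true} rest
      in ℕP.≤ᵇ⇒≤ b a b≤a , test , t′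

  wellOrdered-tail : ∀ x β → T (wellOrdered (x ∷ β)) → T (wellOrdered β)
  wellOrdered-tail x             []            _ = _
  wellOrdered-tail (a , f) ((b , g) ∷ γ) t = proj₂ (proj₂ (unpack a f b g γ t))

  prepend-overlined : ∀ a f o β → o < a → T (wellOrdered ((o , true) ∷ β)) →
                      T (wellOrdered ((a , f) ∷ (o , true) ∷ β))
  prepend-overlined a f o β o<a t =
    ∧-intro {o ≤ᵇ a} (ℕP.≤⇒≤ᵇ (ℕP.<⇒≤ o<a)) (∧-intro {if a ≡ᵇ o then false else true} (overlined-step a o o<a) t)

  prepend-plain : ∀ a f p β → p ≤ a → T (wellOrdered ((p , false) ∷ β)) →
                  T (wellOrdered ((a , f) ∷ (p , false) ∷ β))
  prepend-plain a f p β p≤a t =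
    ∧-intro {p ≤ᵇ a} (ℕP.≤⇒≤ᵇ p≤a) (∧-intro {if a ≡ᵇ p then true else true} (plain-step (a ≡ᵇ p)) t)

  below-mono : ∀ {b a} → b ≤ a → ∀ xs → T (all (_<ᵇ b) xs) → T (all (_<ᵇ a) xs)
  below-mono {b} {a} b≤a = all-mono (λ x x<b → ℕP.<⇒<ᵇ (ℕP.<-≤-trans (ℕP.<ᵇ⇒< x b x<b) b≤a))

  atMost-mono : ∀ {b a} → b ≤ a → ∀ xs → T (all (_≤ᵇ b) xs) → T (all (_≤ᵇ a) xs)
  atMost-mono {b} {a} b≤a = all-mono (λ x x≤b → ℕP.≤⇒≤ᵇ (ℕP.≤-trans (ℕP.≤ᵇ⇒≤ x b x≤b) b≤a))

  head-bounds : ∀ a f β → T (wellOrdered ((a , f) ∷ β)) →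
                T (all (_<ᵇ a) (overlined β)) × T (all (_≤ᵇ a) (plain β))
  head-bounds a f [] _ = _ , _
  head-bounds a f ((b , true) ∷ γ) t =
    let (b≤a , test , t′) = unpack a f b true γ t
        (O< , P≤) = head-bounds b true γ t′
    in ∧-intro {b <ᵇ a} (ℕP.<⇒<ᵇ (overlined-step⁻ a b b≤a test)) (below-mono b≤a (overlined γ) O<) ,
       atMost-mono b≤a (plain γ) P≤
  head-bounds a f ((b , false) ∷ γ) t =
    let (b≤a , _ , t′) = unpack a f b false γ t
        (O< , P≤) = head-bounds b false γ t′
    in below-mono b≤a (overlined γ) O< , ∧-intro {b ≤ᵇ a} (ℕP.≤⇒≤ᵇ b≤a) (atMost-mono b≤a (plain γ) P≤)

  parts-ordered : ∀ α → T (wellOrdered α) → T (decreasing (overlined α)) × T (nonIncreasing (plain α))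
  parts-ordered [] _ = _ , _
  parts-ordered ((a , true) ∷ β) t =
    let (d , ni) = parts-ordered β (wellOrdered-tail (a , true) β t)
    in ∧-intro {all (_<ᵇ a) (overlined β)} (proj₁ (head-bounds a true β t)) d , ni
  parts-ordered ((a , false) ∷ β) t =
    let (d , ni) = parts-ordered β (wellOrdered-tail (a , false) β t)
    in d , ∧-intro {all (_≤ᵇ a) (plain β)} (proj₂ (head-bounds a false β t)) ni

  merge-overlined-head : ∀ a O P → T (all (_≤ᵇ a) P) → merge (a ∷ O) P ≡ (a , true) ∷ merge O P
  merge-overlined-head a O []      _ = refl
  merge-overlined-head a O (p ∷ P) t rewrite Equivalence.to T-≡ (proj₁ (all-∷⁻ {_≤ᵇ a} p P t)) = refl

  merge-plain-head : ∀ a O P → T (all (_<ᵇ a) O) → merge O (a ∷ P) ≡ (a , false) ∷ merge O P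
  merge-plain-head a []      P _ = refl
  merge-plain-head a (o ∷ O) P t with o<a ← ℕP.<ᵇ⇒< o a (proj₁ (all-∷⁻ {_<ᵇ a} o O t))
    rewrite Equivalence.to T-not-≡ (not-intro (λ a≤o → ℕP.<⇒≱ o<a (ℕP.≤ᵇ⇒≤ a o a≤o))) = refl

  merge-parts : ∀ α → T (wellOrdered α) → merge (overlined α) (plain α) ≡ α
  merge-parts [] _ = refl
  merge-parts ((a , true) ∷ β) t =
    trans (merge-overlined-head a (overlined β) (plain β) (proj₂ (head-bounds a true β t)))
          (cong ((a , true) ∷_) (merge-parts β (wellOrdered-tail _ β t)))
  merge-parts ((a , false) ∷ β) t =
    trans (merge-plain-head a (overlined β) (plain β) (proj₁ (head-bounds a false β t)))
          (cong ((a , false) ∷_) (merge-parts β (wellOrdered-tail _ β t)))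

  private
    T-if : ∀ (F : List Part → Bool) b {X Y} → (b ≡ true → T (F X)) → (b ≡ false → T (F Y)) →
           T (F (if b then X else Y))
    T-if F true  x _ = x refl
    T-if F false _ y = y refl

    plain-dominated : ∀ o p P → (p ≤ᵇ o) ≡ true → T (nonIncreasing (p ∷ P)) → T (all (_≤ᵇ o) (p ∷ P))
    plain-dominated o p P e ni =
      let p≤o = ℕP.≤ᵇ⇒≤ p o (Equivalence.from T-≡ e)
      in ∧-intro {p ≤ᵇ o} (ℕP.≤⇒≤ᵇ p≤o) (atMost-mono p≤o P (proj₁ (pairwise-∷⁻ {λ x y → y ≤ᵇ x} p P ni)))

    overlined-dominated : ∀ o p O → (p ≤ᵇ o) ≡ false → T (decreasing (o ∷ O)) → T (all (_<ᵇ p) (o ∷ O))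
    overlined-dominated o p O e d =
      let o<p = ℕP.≰⇒> {p} {o} (λ p≤o → subst T e (ℕP.≤⇒≤ᵇ p≤o))
      in ∧-intro {o <ᵇ p} (ℕP.<⇒<ᵇ o<p)
                 (below-mono (ℕP.<⇒≤ o<p) O (proj₁ (pairwise-∷⁻ {λ x y → y <ᵇ x} o O d)))

  prepend-merge : ∀ a f O P → T (decreasing O) → T (nonIncreasing P) →
                  T (all (_<ᵇ a) O) → T (all (_≤ᵇ a) P) → T (wellOrdered ((a , f) ∷ merge O P))
  prepend-merge a f [] [] _ _ _ _ = _
  prepend-merge a f [] (p ∷ P) _ ni _ aP =
    let (p-bound , ni′) = pairwise-∷⁻ {λ x y → y ≤ᵇ x} p P ni
    in prepend-plain a f p (merge [] P) (ℕP.≤ᵇ⇒≤ p a (proj₁ (all-∷⁻ {_≤ᵇ a} p P aP)))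
                     (prepend-merge p false [] P _ ni′ _ p-bound)
  prepend-merge a f (o ∷ O) [] d _ aO _ =
    let (o-bound , d′) = pairwise-∷⁻ {λ x y → y <ᵇ x} o O d
    in prepend-overlined a f o (merge O []) (ℕP.<ᵇ⇒< o a (proj₁ (all-∷⁻ {_<ᵇ a} o O aO)))
                         (prepend-merge o true O [] d′ _ o-bound _)
  prepend-merge a f (o ∷ O) (p ∷ P) d ni aO aP = T-if (λ β → wellOrdered ((a , f) ∷ β)) (p ≤ᵇ o)
    (λ e → prepend-overlined a f o (merge O (p ∷ P)) (ℕP.<ᵇ⇒< o a (proj₁ (all-∷⁻ {_<ᵇ a} o O aO)))
             (prepend-merge o true O (p ∷ P) (proj₂ (pairwise-∷⁻ {λ x y → y <ᵇ x} o O d)) ni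
                            (proj₁ (pairwise-∷⁻ {λ x y → y <ᵇ x} o O d)) (plain-dominated o p P e ni)))
    (λ e → prepend-plain a f p (merge (o ∷ O) P) (ℕP.≤ᵇ⇒≤ p a (proj₁ (all-∷⁻ {_≤ᵇ a} p P aP)))
             (prepend-merge p false (o ∷ O) P d (proj₂ (pairwise-∷⁻ {λ x y → y ≤ᵇ x} p P ni))
                            (overlined-dominated o p O e d) (proj₁ (pairwise-∷⁻ {λ x y → y ≤ᵇ x} p P ni))))

  merge-wellOrdered : ∀ O P → T (decreasing O) → T (nonIncreasing P) → T (wellOrdered (merge O P))
  merge-wellOrdered []      []      _ _  = _
  merge-wellOrdered []      (p ∷ P) _ ni =
    let (p-bound , ni′) = pairwise-∷⁻ {λ x y → y ≤ᵇ x} p P ni in prepend-merge p false [] P _ ni′ _ p-bound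
  merge-wellOrdered (o ∷ O) []      d _  =
    let (o-bound , d′) = pairwise-∷⁻ {λ x y → y <ᵇ x} o O d in prepend-merge o true O [] d′ _ o-bound _
  merge-wellOrdered (o ∷ O) (p ∷ P) d ni = T-if wellOrdered (p ≤ᵇ o)
    (λ e → prepend-merge o true O (p ∷ P) (proj₂ (pairwise-∷⁻ {λ x y → y <ᵇ x} o O d)) ni
                         (proj₁ (pairwise-∷⁻ {λ x y → y <ᵇ x} o O d)) (plain-dominated o p P e ni))
    (λ e → prepend-merge p false (o ∷ O) P d (proj₂ (pairwise-∷⁻ {λ x y → y ≤ᵇ x} p P ni))
                         (overlined-dominated o p O e d) (proj₁ (pairwise-∷⁻ {λ x y → y ≤ᵇ x} p P ni)))

  numOverlined-length : ∀ α → numOverlined α ≡ length (overlined α)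
  numOverlined-length []                = refl
  numOverlined-length ((a , true)  ∷ α) = cong suc (numOverlined-length α)
  numOverlined-length ((a , false) ∷ α) = numOverlined-length α

  plainAtLeast-≤ : ∀ L α → numPlainAtLeast L α ≤ length (plain α)
  plainAtLeast-≤ L []                = z≤n
  plainAtLeast-≤ L ((a , true)  ∷ α) = plainAtLeast-≤ L α
  plainAtLeast-≤ L ((a , false) ∷ α) with L ≤ᵇ a
  ... | true  = s≤s (plainAtLeast-≤ L α)
  ... | false = ℕP.m≤n⇒m≤1+n (plainAtLeast-≤ L α)

  plainAtLeast-all : ∀ L α → T (all (L ≤ᵇ_) (plain α)) → numPlainAtLeast L α ≡ length (plain α)
  plainAtLeast-all L []                _ = refl
  plainAtLeast-all L ((a , true)  ∷ α) t = plainAtLeast-all L α t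
  plainAtLeast-all L ((a , false) ∷ α) t with L ≤ᵇ a
  ... | true  = cong suc (plainAtLeast-all L α t)

  all-plainAtLeast : ∀ L α → length (plain α) ≤ numPlainAtLeast L α → T (all (L ≤ᵇ_) (plain α))
  all-plainAtLeast L []                _ = _
  all-plainAtLeast L ((a , true)  ∷ α) p = all-plainAtLeast L α p
  all-plainAtLeast L ((a , false) ∷ α) p with L ≤ᵇ a
  ... | true  = all-plainAtLeast L α (ℕP.≤-pred p)
  ... | false = ⊥-elim (ℕP.<-irrefl refl (ℕP.≤-trans p (plainAtLeast-≤ L α)))

  durfee-full : ∀ α → T (durfeeCond α (length α)) ⇔ T (all (length α ≤ᵇ_) (plain α))
  durfee-full α = mk⇔
    (λ t → all-plainAtLeast L α (ℕP.+-cancelˡ-≤ (length (overlined α)) _ _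
             (subst₂ _≤_ (length-parts α) (cong (_+ numPlainAtLeast L α) (numOverlined-length α))
                     (ℕP.≤ᵇ⇒≤ L _ t))))
    (λ t → ℕP.≤⇒≤ᵇ (ℕP.≤-reflexive (trans (length-parts α)
             (sym (cong₂ _+_ (numOverlined-length α) (plainAtLeast-all L α t))))))
    where L = length α

  largestUpTo-≤ : ∀ α k → largestUpTo α k ≤ k
  largestUpTo-≤ α zero    = z≤n
  largestUpTo-≤ α (suc k) with durfeeCond α (suc k)
  ... | true  = ℕP.≤-refl
  ... | false = ℕP.m≤n⇒m≤1+n (largestUpTo-≤ α k)

  largestUpTo-self : ∀ α k → T (k ≡ᵇ largestUpTo α k) ⇔ T (durfeeCond α k)
  largestUpTo-self α k = mk⇔ (to k) (from k)
    where
      to : ∀ k → T (k ≡ᵇ largestUpTo α k) → T (durfeeCond α k)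
      to zero    _ = _
      to (suc k) t with durfeeCond α (suc k)
      ... | true  = _
      ... | false = ℕP.<-irrefl refl
                      (subst (_≤ k) (sym (ℕP.≡ᵇ⇒≡ (suc k) (largestUpTo α k) t)) (largestUpTo-≤ α k))
      from : ∀ k → T (durfeeCond α k) → T (k ≡ᵇ largestUpTo α k)
      from zero    _ = _
      from (suc k) t with durfeeCond α (suc k)
      ... | true  = ℕP.≡⇒≡ᵇ (suc k) (suc k) refl

  parts≡D : ∀ α → T (length α ≡ᵇ D α) ⇔ T (all (length α ≤ᵇ_) (plain α))
  parts≡D α = ⇔-trans (largestUpTo-self α (length α)) (durfee-full α)

  plain-positive : ∀ (O P : List ℕ) → T (all (length O + length P ≤ᵇ_) P) → T (all (1 ≤ᵇ_) P)
  plain-positive O []      _ = _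
  plain-positive O (p ∷ P) =
    atLeast-mono (ℕP.≤-trans (s≤s z≤n) (ℕP.m≤n+m (suc (length P)) (length O))) (p ∷ P)

  InGSet : ℕ → List Part → Set
  InGSet n α = T (IsOverpartitionOf n α ∧ (length α ≡ᵇ D α))

  DurfeePair : ℕ → Pair → Set
  DurfeePair n x = Admissible (size x) x × pairWeight x ≡ n

  DurfeePair-irrelevant : ∀ {n x} → Irrelevant (DurfeePair n x)
  DurfeePair-irrelevant = ×-irrelevant Admissible-irrelevant ℕP.≡-irrelevant

  in-GSet : ∀ n α → InGSet n α ⇔ (T (wellOrdered α) × DurfeePair n (parts α))
  in-GSet n α = mk⇔ to from
    where
      to : InGSet n α → T (wellOrdered α) × DurfeePair n (parts α)
      to t =
        let (ov , d) = ∧-elim {IsOverpartitionOf n α} t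
            (wt , rest) = ∧-elim {weight α ≡ᵇ n} ov
            (pos , wo) = ∧-elim {allPositive α} rest
            (dec , ni) = parts-ordered α wo
            (posO , _) = Equivalence.to (positive-parts α) pos
            bound = subst (λ L → T (all (L ≤ᵇ_) (plain α))) (length-parts α) (Equivalence.to (parts≡D α) d)
        in wo , admissible dec posO ni bound , trans (sym (weight-parts α)) (ℕP.≡ᵇ⇒≡ (weight α) n wt)
      from : T (wellOrdered α) × DurfeePair n (parts α) → InGSet n α
      from (wo , admissible dec posO ni bound , wt) =
        let posP = plain-positive (overlined α) (plain α) bound
            bound′ = subst (λ L → T (all (L ≤ᵇ_) (plain α))) (sym (length-parts α)) bound
        in ∧-intro (∧-intro {weight α ≡ᵇ n} (ℕP.≡⇒≡ᵇ (weight α) n (trans (weight-parts α) wt))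
                            (∧-intro {allPositive α} (Equivalence.from (positive-parts α) (posO , posP)) wo))
                   (Equivalence.from (parts≡D α) bound′)

  overpartitions↔pairs : ∀ n → GSet n ↔ Σ Pair (DurfeePair n)
  overpartitions↔pairs n =
    Σ-image T-irrelevant DurfeePair-irrelevant parts mergePair merged
            (λ α t → merge-parts α (proj₁ (Equivalence.to (in-GSet n α) t))) (λ (O , P) → parts-merge O P)
    where
      mergePair : Pair → List Part
      mergePair (O , P) = merge O P
      merged : ∀ y → InGSet n (mergePair y) ⇔ DurfeePair n y
      merged (O , P) = mk⇔
        (λ t → subst (DurfeePair n) (parts-merge O P) (proj₂ (Equivalence.to (in-GSet n (merge O P)) t)))
        (λ dp@(admissible dec _ ni _ , _) →
           Equivalence.from (in-GSet n (merge O P))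
             (merge-wellOrdered O P dec ni , subst (DurfeePair n) (sym (parts-merge O P)) dp))

module Summation where

  open import Data.Bool using (T)
  open import Data.Bool.Properties using (T-irrelevant)
  open import Data.Bool.ListAction using (all)
  open import Data.List using ([]; _∷_; length)
  open import Data.Nat as ℕ using (ℕ; zero; suc; _≤_; _≤ᵇ_; z≤n; s≤s)
  import Data.Nat.Properties as ℕP
  open import Data.Nat.ListAction using (sum)
  open import Data.Product using (Σ; _×_; _,_; proj₂)
  open import Data.Sum using (_⊎_)
  open import Data.Sum.Function.Propositional using (_⊎-cong_)
  open import Function.Bundles using (_↔_)
  open import Function.Properties.Inverse using (↔-trans)
  open import Relation.Binary.PropositionalEquality
  open import Relation.Nullary using (Irrelevant)
  open Lists
  open Counting
  open Pairs
  open Overpartitions using (DurfeePair; DurfeePair-irrelevant; plain-positive)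
  open PowerSeries using (summand)

  UpTo : ℕ → ℕ → Set
  UpTo n k = Σ Pair (λ x → DurfeePair n x × T (size x ≤ᵇ k))

  UpTo-irrelevant : ∀ {n k x} → Irrelevant (DurfeePair n x × T (size x ≤ᵇ k))
  UpTo-irrelevant = ×-irrelevant DurfeePair-irrelevant T-irrelevant

  length-≤-sum : ∀ xs → T (all (1 ≤ᵇ_) xs) → length xs ≤ sum xs
  length-≤-sum []           _ = z≤n
  length-≤-sum (suc x ∷ xs) t =
    s≤s (ℕP.≤-trans (length-≤-sum xs (proj₂ (all-∷⁻ {1 ≤ᵇ_} (suc x) xs t))) (ℕP.m≤n+m (sum xs) x))

  size-≤-weight : ∀ x → Admissible (size x) x → size x ≤ pairWeight x
  size-≤-weight (O , P) (admissible _ posO _ bound) =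
    ℕP.+-mono-≤ (length-≤-sum O posO) (length-≤-sum P (plain-positive O P bound))

  -- A Durfee pair of weight n has at most n parts.
  all-sizes : ∀ n → Σ Pair (DurfeePair n) ↔ UpTo n n
  all-sizes n = Σ-⇔ DurfeePair-irrelevant UpTo-irrelevant
    (λ x dp@(adm , wt) → dp , ℕP.≤⇒≤ᵇ (subst (size x ≤_) wt (size-≤-weight x adm)))
    (λ x (dp , _) → dp)

  upTo-zero : ∀ n → UpTo n 0 ↔ Obj 0 0 n
  upTo-zero n = Σ-⇔ UpTo-irrelevant (weighted-irrelevant {s = 0})
    (λ x ((adm , wt) , none) →
       let empty = ℕP.n≤0⇒n≡0 (ℕP.≤ᵇ⇒≤ (size x) 0 none)
       in (subst (λ k → Admissible k x) empty adm , empty) , wt)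
    (λ x ((adm , empty) , wt) →
       (subst (λ k → Admissible k x) (sym empty) adm , wt) , ℕP.≤⇒≤ᵇ (ℕP.≤-reflexive empty))

  upTo-suc : ∀ n k → UpTo n (suc k) ↔ (UpTo n k ⊎ Obj (suc k) 0 n)
  upTo-suc n k =
    ↔-trans (Σ-split (λ x → size x ≤ᵇ k))
            (Σ-⇔ (×-irrelevant UpTo-irrelevant T-irrelevant) UpTo-irrelevant
                 (λ x ((dp , _) , ≤k) → dp , ≤k)
                 (λ x (dp , ≤k) → (dp , ℕP.≤⇒≤ᵇ (ℕP.m≤n⇒m≤1+n (ℕP.≤ᵇ⇒≤ (size x) k ≤k))) , ≤k)
             ⊎-cong
             Σ-⇔ (×-irrelevant UpTo-irrelevant T-irrelevant) (weighted-irrelevant {s = 0})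
                 (λ x (((adm , wt) , ≤1+k) , ≰k) →
                    let exact = ℕP.≤-antisym (ℕP.≤ᵇ⇒≤ (size x) (suc k) ≤1+k)
                                             (ℕP.≰⇒> (λ ≤k → not-elim ≰k (ℕP.≤⇒≤ᵇ ≤k)))
                    in (subst (λ j → Admissible j x) exact adm , exact) , wt)
                 (λ x ((adm , exact) , wt) →
                    ((subst (λ j → Admissible j x) (sym exact) adm , wt) , ℕP.≤⇒≤ᵇ (ℕP.≤-reflexive exact)) ,
                    not-intro (λ ≤k → ℕP.<-irrefl refl (subst (_≤ k) exact (ℕP.≤ᵇ⇒≤ (size x) k ≤k)))))

  card-upTo : ∀ n k → Card (UpTo n k) (sumTo k (λ N → summand N n))
  card-upTo n zero    = card-↔ (upTo-zero n) (count n 0)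
  card-upTo n (suc k) = card-↔ (upTo-suc n k) (card-⊎ (card-upTo n k) (count n (suc k)))

open import Data.Nat using (ℕ)
open import Data.Integer using (+_)
open import Data.Fin using (Fin)
open import Data.Product using (Σ; _×_)
open import Function.Bundles using (_↔_)
open import Relation.Binary.PropositionalEquality using (_≡_; sym)
open import Function.Properties.Inverse using (↔-trans)

mainTheorem1 : (n : ℕ) → Σ ℕ (λ g → (GSet n ↔ Fin g) × (+ g ≡ rhsCoeff n))
mainTheorem1 n =
  Counting.card-≡ (PowerSeries.sumTo-cong n (λ N _ → sym (PowerSeries.term≐summand N n)))
    (Counting.card-↔ (↔-trans (Overpartitions.overpartitions↔pairs n) (Summation.all-sizes n))
                     (Summation.card-upTo n n))
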